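{- Let $G$ be a $4$-critical graph with no $(7,2)$-colouring such that $D_3(G)$ contains no odd cycle. Let $x,y,z$ be vertices of degree $3$ with $xy,yz\in E(G)$. Then one can label the two neighbours of $x$ other than $y$ as $x',x''$, the neighbour of $y$ other than $x,z$ as $y'$, and the two neighbours of $z$ other than $y$ as $z',z''$ so that $x'=z'$, $y'x''\in E(G)$, $y'z''\in E(G)$, and $x''\ne z''$. Further, if $x'\ne y'$, then there are two distinct vertices $x_{x',x''},x_{x',z''}\notin\{x,y,z\}$ such that $x_{x',x''}$ is adjacent to $x'$ and $x''$, and $x_{x',z''}$ is adjacent to $x'$ and $z''$.
   Context: A graph is $4$-critical if its chromatic number is $4$ but every proper subgraph is $3$-colourable. A $(7,2)$-colouring is a map $f:V(G)\to\{0,\dots,6\}$ with $2\le|f(u)-f(v)|\le5$ for every edge $uv$. $D_3(G)$ is the subgraph induced by the vertices of degree $3$. -}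

module Defs where

open import Data.Nat using (ℕ; zero; suc; _+_; _*_; _≤_; ∣_-_∣)
open import Data.Fin using (Fin; toℕ; inject₁; fromℕ) renaming (zero to fzero; suc to fsuc)
open import Data.Bool using (Bool; true; false; if_then_else_)
open import Data.List using (List; map; allFin)
open import Data.Nat.ListAction using (sum)
open import Data.Product using (Σ; ∃; _×_; _,_)
open import Data.Sum using (_⊎_)
open import Relation.Binary.PropositionalEquality using (_≡_; _≢_)
open import Relation.Nullary using (¬_)
open import Function.Definitions using (Injective)

record Graph (n : ℕ) : Set where
  field
    adj    : Fin n → Fin n → Bool
    sym    : ∀ u v → adj u v ≡ adj v u
    irrefl : ∀ v → adj v v ≡ false
open Graph public

Adj : ∀ {n} → Graph n → Fin n → Fin n → Set
Adj G u v = adj G u v ≡ true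

deg : ∀ {n} → Graph n → Fin n → ℕ
deg {n} G u = sum (map (λ v → if adj G u v then 1 else 0) (allFin n))

Colourable : ∀ {n} → ℕ → Graph n → Set
Colourable {n} k G = Σ (Fin n → Fin k) λ c → ∀ u v → Adj G u v → c u ≢ c v

ChromaticNumber : ∀ {n} → Graph n → ℕ → Set
ChromaticNumber G zero    = Colourable zero G
ChromaticNumber G (suc k) = Colourable (suc k) G × ¬ Colourable k G

record Subgraph {n : ℕ} (G : Graph n) : Set where
  field
    vs     : Fin n → Bool
    es     : Fin n → Fin n → Bool
    es-sym : ∀ u v → es u v ≡ es v u
    es-sub : ∀ u v → es u v ≡ true → Adj G u v × vs u ≡ true × vs v ≡ true
open Subgraph public

ProperSubgraph : ∀ {n} {G : Graph n} → Subgraph G → Set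
ProperSubgraph {n} {G} H =
  (∃ λ v → vs H v ≡ false) ⊎ (∃ λ u → ∃ λ v → Adj G u v × es H u v ≡ false)

SubColourable : ∀ {n} {G : Graph n} → ℕ → Subgraph G → Set
SubColourable {n} k H =
  Σ (Fin n → Fin k) λ c → ∀ u v → vs H u ≡ true → vs H v ≡ true →
    es H u v ≡ true → c u ≢ c v

Critical : ∀ {n} → ℕ → Graph n → Set
Critical zero    G = ChromaticNumber G zero
Critical (suc k) G = ChromaticNumber G (suc k) ×
  (∀ (H : Subgraph G) → ProperSubgraph H → SubColourable k H)

Colouring72 : ∀ {n} → Graph n → Set
Colouring72 {n} G = Σ (Fin n → Fin 7) λ f → ∀ u v → Adj G u v →
  2 ≤ ∣ toℕ (f u) - toℕ (f v) ∣ × ∣ toℕ (f u) - toℕ (f v) ∣ ≤ 5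

-- D_3(G) contains an odd cycle: there are t ≥ 1 and 2t+1 distinct vertices
-- c_0,…,c_{2t}, all of degree 3, with c_i c_{i+1} ∈ E(G) and c_{2t} c_0 ∈ E(G).
-- (Since D_3(G) is an induced subgraph, its edges are exactly the edges of G
-- between degree-3 vertices.)
D3HasOddCycle : ∀ {n} → Graph n → Set
D3HasOddCycle {n} G = Σ ℕ λ t → 1 ≤ t × Σ (Fin (suc (2 * t)) → Fin n) λ c →
  Injective _≡_ _≡_ c ×
  (∀ i → deg G (c i) ≡ 3) ×
  (∀ (i : Fin (2 * t)) → Adj G (c (inject₁ i)) (c (fsuc i))) ×
  Adj G (c (fromℕ (2 * t))) (c fzero)

{-# OPTIONS --safe #-}
module Submission where

-- x and z are not adjacent, as xyz would be a triangle in D₃(G). By criticality G − y has a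
-- proper 3-colouring, and it gives y's neighbours x, z, w three different colours 0, 1, 2,
-- since otherwise it extends to G. Every claim is then proved by contradiction: if it failed,
-- sending the colour classes to well-separated values of {0,…,6} and re-choosing the values
-- of y and of a few vertices near it would give a (7,2)-colouring. In this way the other
-- neighbours of x get colours 1 and 2 and those of z colours 0 and 2, x and z share their
-- neighbour p of colour 2, w is adjacent to the remaining neighbours x₁ of x and z₁ of z,
-- and if p ≠ w then p has common neighbours with x₁ and with z₁ outside {x, y, z}; these
-- are distinct, since a common one would see all three colours.

open import Defs hiding (sym)
open import Data.Nat using (ℕ; suc; _≤_; ∣_-_∣; _≤?_; s≤s; z≤n)
open import Data.Nat.Properties using (∣-∣-comm)
open import Data.Nat.ListAction using (sum)
open import Data.Fin using (Fin; toℕ; suc; inject₁)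
open import Data.Fin.Patterns using (0F; 1F; 2F; 3F; 4F; 5F; 6F)
open import Data.Fin.Properties using (_≟_; any?; all?)
open import Data.Fin.Permutation using (Permutation′; _⟨$⟩ʳ_; _⟨$⟩ˡ_; inverseˡ; id; transpose; _∘ₚ_)
open import Data.Bool using (Bool; true; false; if_then_else_; not; _∧_)
open import Data.Bool.Properties using (∧-comm) renaming (_≟_ to _≟ᵇ_)
open import Data.List using (List; []; _∷_; map; allFin; filter; length)
open import Data.List.Membership.Propositional using (_∈_; _∉_)
open import Data.List.Membership.Propositional.Properties using (∈-filter⁺; ∈-filter⁻; ∈-allFin; ∈-map⁺)
open import Data.List.Relation.Unary.Any using (here; there) renaming (any? to anyᴸ?)
open import Data.List.Relation.Unary.All using ([]; _∷_; lookup)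
open import Data.List.Relation.Unary.All.Properties using (All¬⇒¬Any)
open import Data.List.Relation.Unary.AllPairs using ([]; _∷_)
open import Data.List.Relation.Unary.Unique.Propositional using (Unique)
open import Data.List.Relation.Unary.Unique.Propositional.Properties using (filter⁺; allFin⁺)
open import Data.Product using (Σ; ∃; ∃₂; _×_; _,_; proj₁; proj₂)
open import Data.Sum using (_⊎_; inj₁; inj₂)
open import Data.Empty using (⊥; ⊥-elim)
open import Data.Vec.Functional using (updateAt)
open import Data.Vec.Functional.Properties using (updateAt-updates; updateAt-minimal)
open import Function using (_∘_; const)
open import Function.Definitions using (Injective)
open import Relation.Nullary using (¬_; Dec; yes; no; does; contradiction)
open import Relation.Nullary.Decidable using (True; toWitness; _×-dec_; _→-dec_; ¬?; dec-true; dec-false; decidable-stable)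
open import Relation.Binary.PropositionalEquality

sum-indicator≡length-filter : ∀ {A : Set} (b : A → Bool) (xs : List A) →
  sum (map (λ v → if b v then 1 else 0) xs) ≡ length (filter (λ v → b v ≟ᵇ true) xs)
sum-indicator≡length-filter b [] = refl
sum-indicator≡length-filter b (v ∷ xs) with b v
... | true  = cong suc (sum-indicator≡length-filter b xs)
... | false = sum-indicator≡length-filter b xs

∧-true⁻ : ∀ {a b} → a ∧ b ≡ true → a ≡ true × b ≡ true
∧-true⁻ {true} b≡true = refl , b≡true

∈-triple : ∀ {A : Set} {v a b c : A} → v ∈ a ∷ b ∷ c ∷ [] → v ≡ a ⊎ v ≡ b ⊎ v ≡ c
∈-triple (here v≡a)                 = inj₁ v≡a
∈-triple (there (here v≡b))         = inj₂ (inj₁ v≡b)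
∈-triple (there (there (here v≡c))) = inj₂ (inj₂ v≡c)

avoid-two : (a b : Fin 3) → ∃ λ e → e ≢ a × e ≢ b
avoid-two 0F 0F = 1F , (λ ()) , (λ ())
avoid-two 0F 1F = 2F , (λ ()) , (λ ())
avoid-two 0F 2F = 1F , (λ ()) , (λ ())
avoid-two 1F 0F = 2F , (λ ()) , (λ ())
avoid-two 1F 1F = 0F , (λ ()) , (λ ())
avoid-two 1F 2F = 0F , (λ ()) , (λ ())
avoid-two 2F 0F = 1F , (λ ()) , (λ ())
avoid-two 2F 1F = 0F , (λ ()) , (λ ())
avoid-two 2F 2F = 0F , (λ ()) , (λ ())

distinct-or-missing : (a b c : Fin 3) → (a ≢ b × a ≢ c × b ≢ c) ⊎ ∃ λ e → e ≢ a × e ≢ b × e ≢ c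
distinct-or-missing a b c with a ≟ b | a ≟ c | b ≟ c
... | yes refl | _        | _        = let e , e≢a , e≢c = avoid-two a c in inj₂ (e , e≢a , e≢a , e≢c)
... | no _     | yes refl | _        = let e , e≢a , e≢b = avoid-two a b in inj₂ (e , e≢a , e≢b , e≢a)
... | no _     | no _     | yes refl = let e , e≢a , e≢b = avoid-two a b in inj₂ (e , e≢a , e≢b , e≢b)
... | no a≢b   | no a≢c   | no b≢c   = inj₁ (a≢b , a≢c , b≢c)

last-colour : (i : Fin 3) → i ≢ 0F → i ≢ 1F → i ≡ 2F
last-colour 0F i≢0 _   = contradiction refl i≢0
last-colour 1F _   i≢1 = contradiction refl i≢1
last-colour 2F _   _   = refl

⟨$⟩ʳ-injective : ∀ {m} (π : Permutation′ m) → Injective _≡_ _≡_ (π ⟨$⟩ʳ_)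
⟨$⟩ʳ-injective π eq = trans (sym (inverseˡ π)) (trans (cong (π ⟨$⟩ˡ_) eq) (inverseˡ π))

normalising : (a b : Fin 3) → a ≢ b → Σ (Permutation′ 3) λ π → π ⟨$⟩ʳ a ≡ 0F × π ⟨$⟩ʳ b ≡ 1F
normalising 0F 0F a≢b = contradiction refl a≢b
normalising 0F 1F _   = id , refl , refl
normalising 0F 2F _   = transpose 1F 2F , refl , refl
normalising 1F 0F _   = transpose 0F 1F , refl , refl
normalising 1F 1F a≢b = contradiction refl a≢b
normalising 1F 2F _   = transpose 0F 1F ∘ₚ transpose 1F 2F , refl , refl
normalising 2F 0F _   = transpose 0F 2F ∘ₚ transpose 1F 2F , refl , refl
normalising 2F 1F _   = transpose 0F 2F , refl , refl
normalising 2F 2F a≢b = contradiction refl a≢b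

≢-by-colour : ∀ {n} (k : Fin n → Fin 3) {u v i j} → k u ≡ i → k v ≡ j → i ≢ j → u ≢ v
≢-by-colour _ ku kv i≢j refl = i≢j (trans (sym ku) kv)

Far : Fin 7 → Fin 7 → Set
Far a b = 2 ≤ ∣ toℕ a - toℕ b ∣ × ∣ toℕ a - toℕ b ∣ ≤ 5

Far? : ∀ a b → Dec (Far a b)
Far? a b = (2 ≤? ∣ toℕ a - toℕ b ∣) ×-dec (∣ toℕ a - toℕ b ∣ ≤? 5)

Far-sym : ∀ {a b} → Far a b → Far b a
Far-sym {a} {b} = subst (λ d → 2 ≤ d × d ≤ 5) (∣-∣-comm (toℕ a) (toℕ b))

Far-resp : ∀ {a b c d} → a ≡ c → b ≡ d → Far c d → Far a b
Far-resp a≡c b≡d = subst₂ Far (sym a≡c) (sym b≡d)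

far′ : ∀ a b {t : True (Far? a b)} → Far a b
far′ a b {t} = toWitness t

far : ∀ {a b c d} → a ≡ c → b ≡ d → {t : True (Far? c d)} → Far a b
far {c = c} {d} a≡c b≡d {t} = Far-resp a≡c b≡d (far′ c d {t})

palette : Fin 7 → Fin 7 → Fin 7 → Fin 3 → Fin 7
palette a b c 0F = a
palette a b c 1F = b
palette a b c 2F = c

Separating : (Fin 3 → Fin 7) → (Fin 3 → Fin 7) → Set
Separating τ τ′ = ∀ i j → i ≢ j → Far (τ i) (τ′ j)

Separating? : ∀ τ τ′ → Dec (Separating τ τ′)
Separating? τ τ′ = all? λ i → all? λ j → ¬? (i ≟ j) →-dec Far? (τ i) (τ′ j)

separating : ∀ τ τ′ {_ : True (Separating? τ τ′)} → Separating τ τ′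
separating τ τ′ {t} = toWitness t

Fits : Fin 7 → Fin 3 → (Fin 3 → Fin 7) → Set
Fits c i τ = ∀ j → j ≢ i → Far c (τ j)

Fits? : ∀ c i τ → Dec (Fits c i τ)
Fits? c i τ = all? λ j → ¬? (j ≟ i) →-dec Far? c (τ j)

fits : ∀ c i τ {_ : True (Fits? c i τ)} → Fits c i τ
fits c i τ {t} = toWitness t

override : ∀ {n} → List (Fin n × Fin 7) → (Fin n → Fin 7) → Fin n → Fin 7
override []             g = g
override ((s , c) ∷ os) g = updateAt (override os g) s (const c)

override-∉ : ∀ {n} {os : List (Fin n × Fin 7)} {g v} → v ∉ map proj₁ os → override os g v ≡ g v
override-∉ {os = []}           _   = refl
override-∉ {os = (s , _) ∷ os} v∉S =
  trans (updateAt-minimal _ s _ (v∉S ∘ here)) (override-∉ (v∉S ∘ there))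

override-∈ : ∀ {n} {os : List (Fin n × Fin 7)} {g v c} → Unique (map proj₁ os) → (v , c) ∈ os →
  override os g v ≡ c
override-∈ {os = (s , _) ∷ os} _                  (here refl) = updateAt-updates s _
override-∈ {os = (s , _) ∷ os} (s∉rest ∷ unique) (there v∈)  =
  trans (updateAt-minimal _ s _ (≢-sym (lookup s∉rest (∈-map⁺ proj₁ v∈)))) (override-∈ unique v∈)

module _ {n : ℕ} (G : Graph n) where

  Adj-sym : ∀ {u v} → Adj G u v → Adj G v u
  Adj-sym {u} {v} uv = trans (Graph.sym G v u) uv

  Adj⇒≢ : ∀ {u v} → Adj G u v → u ≢ v
  Adj⇒≢ {u} uu refl with trans (sym uu) (irrefl G u)
  ... | ()

  triangle⇒D3HasOddCycle : ∀ {x y z} → deg G x ≡ 3 → deg G y ≡ 3 → deg G z ≡ 3 →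
    Adj G x y → Adj G y z → Adj G z x → D3HasOddCycle G
  triangle⇒D3HasOddCycle {x} {y} {z} dx dy dz xy yz zx =
    1 , s≤s z≤n , cycle , cycle-injective , cycle-deg , cycle-adj , zx
    where
    cycle : Fin 3 → Fin n
    cycle 0F = x
    cycle 1F = y
    cycle 2F = z

    cycle-injective : Injective _≡_ _≡_ cycle
    cycle-injective {0F} {0F} _ = refl
    cycle-injective {0F} {1F} x≡y = contradiction x≡y (Adj⇒≢ xy)
    cycle-injective {0F} {2F} x≡z = contradiction (sym x≡z) (Adj⇒≢ zx)
    cycle-injective {1F} {0F} y≡x = contradiction (sym y≡x) (Adj⇒≢ xy)
    cycle-injective {1F} {1F} _ = refl
    cycle-injective {1F} {2F} y≡z = contradiction y≡z (Adj⇒≢ yz)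
    cycle-injective {2F} {0F} z≡x = contradiction z≡x (Adj⇒≢ zx)
    cycle-injective {2F} {1F} z≡y = contradiction (sym z≡y) (Adj⇒≢ yz)
    cycle-injective {2F} {2F} _ = refl

    cycle-deg : ∀ i → deg G (cycle i) ≡ 3
    cycle-deg 0F = dx
    cycle-deg 1F = dy
    cycle-deg 2F = dz

    cycle-adj : ∀ (i : Fin 2) → Adj G (cycle (inject₁ i)) (cycle (suc i))
    cycle-adj 0F = xy
    cycle-adj 1F = yz

  record Neighbours (x a b c : Fin n) : Set where
    field
      adj-a    : Adj G x a
      adj-b    : Adj G x b
      adj-c    : Adj G x c
      a≢b      : a ≢ b
      a≢c      : a ≢ c
      b≢c      : b ≢ c
      complete : ∀ v → Adj G x v → v ≡ a ⊎ v ≡ b ⊎ v ≡ c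

  swap₁₂ : ∀ {x a b c} → Neighbours x a b c → Neighbours x b a c
  swap₁₂ {a = a} {b} {c} N = record
    { adj-a = adj-b ; adj-b = adj-a ; adj-c = adj-c
    ; a≢b = ≢-sym a≢b ; a≢c = b≢c ; b≢c = a≢c
    ; complete = λ v xv → reorder (complete v xv)
    }
    where
    open Neighbours N
    reorder : ∀ {v} → v ≡ a ⊎ v ≡ b ⊎ v ≡ c → v ≡ b ⊎ v ≡ a ⊎ v ≡ c
    reorder (inj₁ v≡a)        = inj₂ (inj₁ v≡a)
    reorder (inj₂ (inj₁ v≡b)) = inj₁ v≡b
    reorder (inj₂ (inj₂ v≡c)) = inj₂ (inj₂ v≡c)

  swap₂₃ : ∀ {x a b c} → Neighbours x a b c → Neighbours x a c b
  swap₂₃ {a = a} {b} {c} N = record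
    { adj-a = adj-a ; adj-b = adj-c ; adj-c = adj-b
    ; a≢b = a≢c ; a≢c = a≢b ; b≢c = ≢-sym b≢c
    ; complete = λ v xv → reorder (complete v xv)
    }
    where
    open Neighbours N
    reorder : ∀ {v} → v ≡ a ⊎ v ≡ b ⊎ v ≡ c → v ≡ a ⊎ v ≡ c ⊎ v ≡ b
    reorder (inj₁ v≡a)        = inj₁ v≡a
    reorder (inj₂ (inj₁ v≡b)) = inj₂ (inj₂ v≡b)
    reorder (inj₂ (inj₂ v≡c)) = inj₂ (inj₁ v≡c)

  neighbourList : Fin n → List (Fin n)
  neighbourList x = filter (λ v → adj G x v ≟ᵇ true) (allFin n)

  degree3⇒Neighbours : ∀ {x y} → deg G x ≡ 3 → Adj G x y → ∃₂ λ a b → Neighbours x y a b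
  degree3⇒Neighbours {x} {y} dx xy =
    fromTriple (neighbourList x) refl (trans (sym (sum-indicator≡length-filter (adj G x) (allFin n))) dx)
               (filter⁺ _ (allFin⁺ n))
    where
    listed : ∀ {v} → Adj G x v → v ∈ neighbourList x
    listed xv = ∈-filter⁺ _ (∈-allFin _) xv

    fromTriple : (L : List (Fin n)) → L ≡ neighbourList x → length L ≡ 3 → Unique L →
                 ∃₂ λ a b → Neighbours x y a b
    fromTriple (a ∷ b ∷ c ∷ []) L≡ _ ((a≢b ∷ a≢c ∷ []) ∷ (b≢c ∷ []) ∷ [] ∷ []) = place (inL xy)
      where
      inL : ∀ {v} → Adj G x v → v ∈ a ∷ b ∷ c ∷ []
      inL xv = subst (_ ∈_) (sym L≡) (listed xv)

      adjL : ∀ {v} → v ∈ a ∷ b ∷ c ∷ [] → Adj G x v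
      adjL v∈L = proj₂ (∈-filter⁻ _ {xs = allFin n} (subst (_ ∈_) L≡ v∈L))

      N : Neighbours x a b c
      N = record
        { adj-a = adjL (here refl) ; adj-b = adjL (there (here refl))
        ; adj-c = adjL (there (there (here refl)))
        ; a≢b = a≢b ; a≢c = a≢c ; b≢c = b≢c
        ; complete = λ v xv → ∈-triple (inL xv)
        }

      place : y ∈ a ∷ b ∷ c ∷ [] → ∃₂ λ a b → Neighbours x y a b
      place (here refl)                 = b , c , N
      place (there (here refl))         = a , c , swap₁₂ N
      place (there (there (here refl))) = a , b , swap₁₂ (swap₂₃ N)

  third-neighbour : ∀ {y x z a b} → Neighbours y x a b → Adj G y z → z ≢ x → ∃ λ w → Neighbours y x z w
  third-neighbour {a = a} {b} N yz z≢x with Neighbours.complete N _ yz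
  ... | inj₁ z≡x        = contradiction z≡x z≢x
  ... | inj₂ (inj₁ refl) = b , N
  ... | inj₂ (inj₂ refl) = a , swap₂₃ N

  ProperAwayFrom : Fin n → (Fin n → Fin 3) → Set
  ProperAwayFrom y k = ∀ u v → u ≢ y → v ≢ y → Adj G u v → k u ≢ k v

  survives : Fin n → Fin n → Bool
  survives y v = not (does (v ≟ y))

  deleteVertex : Fin n → Subgraph G
  deleteVertex y = record
    { vs     = survives y
    ; es     = λ u v → adj G u v ∧ (survives y u ∧ survives y v)
    ; es-sym = λ u v → cong₂ _∧_ (Graph.sym G u v) (∧-comm (survives y u) (survives y v))
    ; es-sub = λ u v e → let uv , uv-survive = ∧-true⁻ e in uv , ∧-true⁻ uv-survive
    }

  critical⇒ProperAwayFrom : Critical 4 G → ∀ y → ∃ (ProperAwayFrom y)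
  critical⇒ProperAwayFrom (_ , colourable) y = c , proper
    where
    deleted : ProperSubgraph (deleteVertex y)
    deleted = inj₁ (y , cong not (dec-true (y ≟ y) refl))

    c : Fin n → Fin 3
    c = proj₁ (colourable (deleteVertex y) deleted)

    survivor : ∀ {u} → u ≢ y → survives y u ≡ true
    survivor u≢y = cong not (dec-false (_ ≟ y) u≢y)

    proper : ProperAwayFrom y c
    proper u v u≢y v≢y uv = proj₂ (colourable (deleteVertex y) deleted) u v (survivor u≢y) (survivor v≢y)
      (cong₂ _∧_ uv (cong₂ _∧_ (survivor u≢y) (survivor v≢y)))

  missing-colour⇒Colourable : ∀ {y x z w k e} → ProperAwayFrom y k → Neighbours y x z w →
    e ≢ k x → e ≢ k z → e ≢ k w → Colourable 3 G
  missing-colour⇒Colourable {y} {k = k} {e} proper N e≢kx e≢kz e≢kw = k′ , proper′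
    where
    k′ : Fin n → Fin 3
    k′ = updateAt k y (const e)

    k′-y : k′ y ≡ e
    k′-y = updateAt-updates y k

    k′-off : ∀ {v} → v ≢ y → k′ v ≡ k v
    k′-off v≢y = updateAt-minimal _ y k v≢y

    avoids : ∀ v → Adj G y v → e ≢ k v
    avoids v yv with Neighbours.complete N v yv
    ... | inj₁ refl        = e≢kx
    ... | inj₂ (inj₁ refl) = e≢kz
    ... | inj₂ (inj₂ refl) = e≢kw

    proper′ : ∀ u v → Adj G u v → k′ u ≢ k′ v
    proper′ u v uv with u ≟ y | v ≟ y
    ... | yes refl | yes refl = contradiction refl (Adj⇒≢ uv)
    ... | yes refl | no v≢y   = λ eq → avoids v uv (trans (sym k′-y) (trans eq (k′-off v≢y)))
    ... | no u≢y   | yes refl =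
      λ eq → avoids u (Adj-sym uv) (trans (sym k′-y) (trans (sym eq) (k′-off u≢y)))
    ... | no u≢y   | no v≢y   =
      λ eq → proper u v u≢y v≢y uv (trans (sym (k′-off u≢y)) (trans eq (k′-off v≢y)))

  ProperAwayFrom-permute : ∀ {y k} (π : Permutation′ 3) →
    ProperAwayFrom y k → ProperAwayFrom y ((π ⟨$⟩ʳ_) ∘ k)
  ProperAwayFrom-permute π proper u v u≢y v≢y uv = proper u v u≢y v≢y uv ∘ ⟨$⟩ʳ-injective π

  standard-colouring : ∀ {y x z w} → Critical 4 G → Neighbours y x z w →
    ∃ λ k → ProperAwayFrom y k × k x ≡ 0F × k z ≡ 1F × k w ≡ 2F
  standard-colouring {y} {x} {z} {w} critical N with critical⇒ProperAwayFrom critical y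
  ... | c , proper with distinct-or-missing (c x) (c z) (c w)
  ...   | inj₂ (e , e≢cx , e≢cz , e≢cw) =
          contradiction (missing-colour⇒Colourable proper N e≢cx e≢cz e≢cw) (proj₂ (proj₁ critical))
  ...   | inj₁ (cx≢cz , cx≢cw , cz≢cw) with normalising (c x) (c z) cx≢cz
  ...     | π , πcx≡0 , πcz≡1 =
            (π ⟨$⟩ʳ_) ∘ c , ProperAwayFrom-permute π proper , πcx≡0 , πcz≡1 ,
            last-colour _ (cx≢cw ∘ ⟨$⟩ʳ-injective π ∘ trans πcx≡0 ∘ sym)
                          (cz≢cw ∘ ⟨$⟩ʳ-injective π ∘ trans πcz≡1 ∘ sym)

  -- y is one of the re-chosen vertices, so every other edge joins different colour classes.
  module Recolouring {y k} (proper : ProperAwayFrom y k)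
      (σ : Fin n → Fin 3 → Fin 7) (σ-separating : ∀ u v → Separating (σ u) (σ v))
      (os : List (Fin n × Fin 7)) (unique : Unique (map proj₁ os)) (y∈S : y ∈ map proj₁ os) where

    S : List (Fin n)
    S = map proj₁ os

    f : Fin n → Fin 7
    f = override os (λ v → σ v (k v))

    f-∉ : ∀ {v} → v ∉ S → f v ≡ σ v (k v)
    f-∉ = override-∉

    f-∈ : ∀ {v c} → (v , c) ∈ os → f v ≡ c
    f-∈ = override-∈ unique

    ∉S⇒≢y : ∀ {v} → v ∉ S → v ≢ y
    ∉S⇒≢y v∉S refl = v∉S y∈S

    colouring : (∀ s v → s ∈ S → Adj G s v → Far (f s) (f v)) → Colouring72 G
    colouring special = f , edge
      where
      edge : ∀ u v → Adj G u v → Far (f u) (f v)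
      edge u v uv with anyᴸ? (u ≟_) S | anyᴸ? (v ≟_) S
      ... | yes u∈S | _       = special u v u∈S uv
      ... | no _    | yes v∈S = Far-sym {f v} (special v u v∈S (Adj-sym uv))
      ... | no u∉S  | no v∉S  = Far-resp (f-∉ u∉S) (f-∉ v∉S)
            (σ-separating u v (k u) (k v) (proper u v (∉S⇒≢y u∉S) (∉S⇒≢y v∉S) uv))

    far-at-special : ∀ {s c i} → s ≢ y → f s ≡ c → k s ≡ i →
      (∀ v → v ∉ S → v ≢ y → k v ≢ i → Adj G s v → Far c (σ v (k v))) →
      (∀ t → t ∈ S → Adj G s t → Far (f s) (f t)) →
      ∀ v → Adj G s v → Far (f s) (f v)
    far-at-special {s} s≢y fs ks outside inside v sv with anyᴸ? (v ≟_) S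
    ... | yes v∈S = inside v v∈S sv
    ... | no v∉S  = Far-resp fs (f-∉ v∉S)
          (outside v v∉S (∉S⇒≢y v∉S) (λ kv≡i → proper s v s≢y (∉S⇒≢y v∉S) sv (trans ks (sym kv≡i))) sv)

  module Configuration {y k} (proper : ProperAwayFrom y k) (no72 : ¬ Colouring72 G)
      {x z w} (Ny : Neighbours y x z w) (kx : k x ≡ 0F) (kz : k z ≡ 1F) (kw : k w ≡ 2F)
      (x≁z : ¬ Adj G x z) where

    open Neighbours

    x≢y : x ≢ y
    x≢y = ≢-sym (Adj⇒≢ (adj-a Ny))

    z≢y : z ≢ y
    z≢y = ≢-sym (Adj⇒≢ (adj-b Ny))

    w≢y : w ≢ y
    w≢y = ≢-sym (Adj⇒≢ (adj-c Ny))

    z≢x : z ≢ x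
    z≢x = ≢-by-colour k kz kx λ ()

    w≢x : w ≢ x
    w≢x = ≢-by-colour k kw kx λ ()

    w≢z : w ≢ z
    w≢z = ≢-by-colour k kw kz λ ()

    x-neighbour≢z : ∀ {u} → Adj G x u → u ≢ z
    x-neighbour≢z xu refl = x≁z xu

    class1-x-neighbour≁y : ∀ {u} → Adj G x u → k u ≡ 1F → ¬ Adj G u y
    class1-x-neighbour≁y {u} xu ku uy with complete Ny u (Adj-sym uy)
    ... | inj₁ refl        = Adj⇒≢ xu refl
    ... | inj₂ (inj₁ refl) = x≁z xu
    ... | inj₂ (inj₂ refl) = ≢-by-colour k ku kw (λ ()) refl

    τ₀₂₄ : Fin 3 → Fin 7
    τ₀₂₄ = palette 0F 2F 4F

    same-class⇒Colouring72 : ∀ {x₁ x₂ j} (a b : Fin 7) → Neighbours x y x₁ x₂ → k x₁ ≡ j → k x₂ ≡ j →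
      Far a b → Far a 2F → Far a 4F → Far b (τ₀₂₄ j) → Colouring72 G
    same-class⇒Colouring72 {x₁} {x₂} a b Nx kx₁ kx₂ ab a2 a4 bj = colouring special
      where
      open Recolouring proper (λ _ → τ₀₂₄) (λ _ _ → separating τ₀₂₄ τ₀₂₄)
        ((y , a) ∷ (x , b) ∷ []) ((≢-sym x≢y ∷ []) ∷ [] ∷ []) (here refl)

      fy : f y ≡ a
      fy = f-∈ (here refl)

      fx : f x ≡ b
      fx = f-∈ (there (here refl))

      plain : ∀ {v i} → v ≢ y → v ≢ x → k v ≡ i → f v ≡ τ₀₂₄ i
      plain v≢y v≢x kv = trans (f-∉ (All¬⇒¬Any (v≢y ∷ v≢x ∷ []))) (cong τ₀₂₄ kv)

      special : ∀ s v → s ∈ S → Adj G s v → Far (f s) (f v)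
      special _ v (here refl) yv with complete Ny v yv
      ... | inj₁ refl        = Far-resp fy fx ab
      ... | inj₂ (inj₁ refl) = Far-resp fy (plain z≢y z≢x kz) a2
      ... | inj₂ (inj₂ refl) = Far-resp fy (plain w≢y w≢x kw) a4
      special _ v (there (here refl)) xv with complete Nx v xv
      ... | inj₁ refl        = Far-resp fx fy (Far-sym {a} ab)
      ... | inj₂ (inj₁ refl) = Far-resp fx (plain (≢-sym (a≢b Nx)) (≢-sym (Adj⇒≢ xv)) kx₁) bj
      ... | inj₂ (inj₂ refl) = Far-resp fx (plain (≢-sym (a≢c Nx)) (≢-sym (Adj⇒≢ xv)) kx₂) bj

    neighbour-classes : ∀ {a b} → Neighbours x y a b →
      ∃₂ λ x₁ p → Neighbours x y x₁ p × k x₁ ≡ 1F × k p ≡ 2F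
    neighbour-classes {a} {b} Nx with k a in ka | k b in kb
    ... | 0F | _  = ⊥-elim (proper x a x≢y (≢-sym (a≢b Nx)) (adj-b Nx) (trans kx (sym ka)))
    ... | 1F | 0F = ⊥-elim (proper x b x≢y (≢-sym (a≢c Nx)) (adj-c Nx) (trans kx (sym kb)))
    ... | 2F | 0F = ⊥-elim (proper x b x≢y (≢-sym (a≢c Nx)) (adj-c Nx) (trans kx (sym kb)))
    ... | 1F | 1F = ⊥-elim (no72 (same-class⇒Colouring72 0F 4F Nx ka kb
                                     (far′ 0F 4F) (far′ 0F 2F) (far′ 0F 4F) (far′ 4F 2F)))
    ... | 2F | 2F = ⊥-elim (no72 (same-class⇒Colouring72 6F 1F Nx ka kb
                                     (far′ 6F 1F) (far′ 6F 2F) (far′ 6F 4F) (far′ 1F 4F)))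
    ... | 1F | 2F = a , b , Nx , ka , kb
    ... | 2F | 1F = b , a , swap₂₃ Nx , kb , ka

    distinct-class2⇒Colouring72 : ∀ {x₁ x₂ z₁ z₂} → Neighbours x y x₁ x₂ → Neighbours z y z₁ z₂ →
      k x₁ ≡ 1F → k x₂ ≡ 2F → k z₁ ≡ 0F → k z₂ ≡ 2F → x₂ ≢ z₂ → Colouring72 G
    distinct-class2⇒Colouring72 {x₁} {x₂} {z₁} {z₂} Nx Nz kx₁ kx₂ kz₁ kz₂ x₂≢z₂ = colouring special
      where
      x≢z₂ : x ≢ z₂
      x≢z₂ = ≢-by-colour k kx kz₂ λ ()

      z≢z₂ : z ≢ z₂
      z≢z₂ = ≢-by-colour k kz kz₂ λ ()

      z₂≢y : z₂ ≢ y
      z₂≢y = ≢-sym (a≢c Nz)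

      open Recolouring proper (λ _ → τ₀₂₄) (λ _ _ → separating τ₀₂₄ τ₀₂₄)
        ((y , 1F) ∷ (x , 6F) ∷ (z , 3F) ∷ (z₂ , 5F) ∷ [])
        ((≢-sym x≢y ∷ ≢-sym z≢y ∷ ≢-sym z₂≢y ∷ []) ∷ (≢-sym z≢x ∷ x≢z₂ ∷ []) ∷ (z≢z₂ ∷ []) ∷ [] ∷ [])
        (here refl)

      fy : f y ≡ 1F
      fy = f-∈ (here refl)

      fx : f x ≡ 6F
      fx = f-∈ (there (here refl))

      fz : f z ≡ 3F
      fz = f-∈ (there (there (here refl)))

      fz₂ : f z₂ ≡ 5F
      fz₂ = f-∈ (there (there (there (here refl))))

      plain : ∀ {v i} → v ≢ y → v ≢ x → v ≢ z → v ≢ z₂ → k v ≡ i → f v ≡ τ₀₂₄ i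
      plain v≢y v≢x v≢z v≢z₂ kv = trans (f-∉ (All¬⇒¬Any (v≢y ∷ v≢x ∷ v≢z ∷ v≢z₂ ∷ []))) (cong τ₀₂₄ kv)

      z₂≁x : ¬ Adj G z₂ x
      z₂≁x z₂x with complete Nx z₂ (Adj-sym z₂x)
      ... | inj₁ z₂≡y        = z₂≢y z₂≡y
      ... | inj₂ (inj₁ z₂≡x₁) = ≢-by-colour k kz₂ kx₁ (λ ()) z₂≡x₁
      ... | inj₂ (inj₂ z₂≡x₂) = x₂≢z₂ (sym z₂≡x₂)

      special : ∀ s v → s ∈ S → Adj G s v → Far (f s) (f v)
      special _ v (here refl) yv with complete Ny v yv | v ≟ z₂
      ... | inj₁ refl        | _        = far fy fx
      ... | inj₂ (inj₁ refl) | _        = far fy fz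
      ... | inj₂ (inj₂ refl) | yes refl = far fy fz₂
      ... | inj₂ (inj₂ refl) | no w≢z₂  = far fy (plain w≢y w≢x w≢z w≢z₂ kw)
      special _ v (there (here refl)) xv with complete Nx v xv
      ... | inj₁ refl        = far fx fy
      ... | inj₂ (inj₁ refl) = far fx (plain (≢-sym (a≢b Nx)) (≢-sym (Adj⇒≢ xv)) (x-neighbour≢z xv)
                                              (≢-by-colour k kx₁ kz₂ λ ()) kx₁)
      ... | inj₂ (inj₂ refl) = far fx (plain (≢-sym (a≢c Nx)) (≢-sym (Adj⇒≢ xv))
                                              (≢-by-colour k kx₂ kz λ ()) x₂≢z₂ kx₂)
      special _ v (there (there (here refl))) zv with complete Nz v zv
      ... | inj₁ refl        = far fz fy
      ... | inj₂ (inj₁ refl) = far fz (plain (≢-sym (a≢b Nz)) (λ { refl → x≁z (Adj-sym zv) })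
                                              (≢-sym (Adj⇒≢ zv)) (≢-by-colour k kz₁ kz₂ λ ()) kz₁)
      ... | inj₂ (inj₂ refl) = far fz fz₂
      special _ v (there (there (there (here refl)))) =
        far-at-special z₂≢y fz₂ kz₂ (λ v _ _ kv≢2 _ → fits 5F 2F τ₀₂₄ (k v) kv≢2) inside v
        where
        inside : ∀ t → t ∈ S → Adj G z₂ t → Far (f z₂) (f t)
        inside _ (here refl)                         _   = far fz₂ fy
        inside _ (there (here refl))                 z₂x = ⊥-elim (z₂≁x z₂x)
        inside _ (there (there (here refl)))         _   = far fz₂ fz
        inside _ (there (there (there (here refl)))) z₂z₂ = ⊥-elim (Adj⇒≢ z₂z₂ refl)

    w≁x₁⇒Colouring72 : ∀ {x₁ p} → Neighbours x y x₁ p → k x₁ ≡ 1F → k p ≡ 2F → ¬ Adj G w x₁ →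
      Colouring72 G
    w≁x₁⇒Colouring72 {x₁} {p} Nx kx₁ kp w≁x₁ = colouring special
      where
      τ : Fin 3 → Fin 7
      τ = palette 0F 2F 5F

      x₁≢y : x₁ ≢ y
      x₁≢y = ≢-sym (a≢b Nx)

      x₁≢x : x₁ ≢ x
      x₁≢x = ≢-sym (Adj⇒≢ (adj-b Nx))

      x₁≢w : x₁ ≢ w
      x₁≢w = ≢-by-colour k kx₁ kw λ ()

      open Recolouring proper (λ _ → τ) (λ _ _ → separating τ τ)
        ((y , 6F) ∷ (x , 1F) ∷ (x₁ , 3F) ∷ (w , 4F) ∷ [])
        ((≢-sym x≢y ∷ ≢-sym x₁≢y ∷ ≢-sym w≢y ∷ []) ∷ (≢-sym x₁≢x ∷ ≢-sym w≢x ∷ []) ∷ (x₁≢w ∷ []) ∷ [] ∷ [])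
        (here refl)

      fy : f y ≡ 6F
      fy = f-∈ (here refl)

      fx : f x ≡ 1F
      fx = f-∈ (there (here refl))

      fx₁ : f x₁ ≡ 3F
      fx₁ = f-∈ (there (there (here refl)))

      fw : f w ≡ 4F
      fw = f-∈ (there (there (there (here refl))))

      plain : ∀ {v i} → v ≢ y → v ≢ x → v ≢ x₁ → v ≢ w → k v ≡ i → f v ≡ τ i
      plain v≢y v≢x v≢x₁ v≢w kv = trans (f-∉ (All¬⇒¬Any (v≢y ∷ v≢x ∷ v≢x₁ ∷ v≢w ∷ []))) (cong τ kv)

      special : ∀ s v → s ∈ S → Adj G s v → Far (f s) (f v)
      special _ v (here refl) yv with complete Ny v yv
      ... | inj₁ refl        = far fy fx
      ... | inj₂ (inj₁ refl) = far fy (plain z≢y z≢x (≢-sym (x-neighbour≢z (adj-b Nx))) (≢-sym w≢z) kz)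
      ... | inj₂ (inj₂ refl) = far fy fw
      special _ v (there (here refl)) xv with complete Nx v xv | v ≟ w
      ... | inj₁ refl        | _        = far fx fy
      ... | inj₂ (inj₁ refl) | _        = far fx fx₁
      ... | inj₂ (inj₂ refl) | yes refl = far fx fw
      ... | inj₂ (inj₂ refl) | no p≢w   = far fx (plain (≢-sym (a≢c Nx)) (≢-sym (Adj⇒≢ xv))
                                                        (≢-by-colour k kp kx₁ λ ()) p≢w kp)
      special _ v (there (there (here refl))) =
        far-at-special x₁≢y fx₁ kx₁ (λ v _ _ kv≢1 _ → fits 3F 1F τ (k v) kv≢1) inside v
        where
        inside : ∀ t → t ∈ S → Adj G x₁ t → Far (f x₁) (f t)
        inside _ (here refl)                         x₁y  = ⊥-elim (class1-x-neighbour≁y (adj-b Nx) kx₁ x₁y)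
        inside _ (there (here refl))                 _    = far fx₁ fx
        inside _ (there (there (here refl)))         x₁x₁ = ⊥-elim (Adj⇒≢ x₁x₁ refl)
        inside _ (there (there (there (here refl)))) x₁w  = ⊥-elim (w≁x₁ (Adj-sym x₁w))
      special _ v (there (there (there (here refl)))) =
        far-at-special w≢y fw kw (λ v _ _ kv≢2 _ → fits 4F 2F τ (k v) kv≢2) inside v
        where
        inside : ∀ t → t ∈ S → Adj G w t → Far (f w) (f t)
        inside _ (here refl)                         _   = far fw fy
        inside _ (there (here refl))                 _   = far fw fx
        inside _ (there (there (here refl)))         wx₁ = ⊥-elim (w≁x₁ wx₁)
        inside _ (there (there (there (here refl)))) ww  = ⊥-elim (Adj⇒≢ ww refl)

    FreshCommonNeighbour : Fin n → Fin n → Fin n → Set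
    FreshCommonNeighbour u v a = (a ≢ x × a ≢ y × a ≢ z) × Adj G a u × Adj G a v

    FreshCommonNeighbour? : ∀ u v a → Dec (FreshCommonNeighbour u v a)
    FreshCommonNeighbour? u v a =
      (¬? (a ≟ x) ×-dec ¬? (a ≟ y) ×-dec ¬? (a ≟ z)) ×-dec
      (adj G a u ≟ᵇ true) ×-dec (adj G a v ≟ᵇ true)

    -- Colour-0 vertices adjacent to p are raised from 2 to 3, which frees the value 1 for p.
    shade : Bool → Fin 3 → Fin 7
    shade adjacent = palette (if adjacent then 3F else 2F) 5F 0F

    shades-separating : ∀ b b′ → Separating (shade b) (shade b′)
    shades-separating true  true  = separating (shade true)  (shade true)
    shades-separating true  false = separating (shade true)  (shade false)
    shades-separating false true  = separating (shade false) (shade true)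
    shades-separating false false = separating (shade false) (shade false)

    no-fresh-common-neighbour⇒Colouring72 : ∀ {x₁ p} → Neighbours x y x₁ p → k x₁ ≡ 1F → k p ≡ 2F →
      p ≢ w → ¬ ∃ (FreshCommonNeighbour p x₁) → Colouring72 G
    no-fresh-common-neighbour⇒Colouring72 {x₁} {p} Nx kx₁ kp p≢w no-fresh = colouring special
      where
      x₁≢y : x₁ ≢ y
      x₁≢y = ≢-sym (a≢b Nx)

      p≢y : p ≢ y
      p≢y = ≢-sym (a≢c Nx)

      x₁≢x : x₁ ≢ x
      x₁≢x = ≢-sym (Adj⇒≢ (adj-b Nx))

      p≢x : p ≢ x
      p≢x = ≢-sym (Adj⇒≢ (adj-c Nx))

      p≢x₁ : p ≢ x₁
      p≢x₁ = ≢-by-colour k kp kx₁ λ ()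

      open Recolouring proper (λ v → shade (adj G p v)) (λ u v → shades-separating (adj G p u) (adj G p v))
        ((y , 2F) ∷ (x , 6F) ∷ (p , 1F) ∷ (x₁ , 4F) ∷ [])
        ((≢-sym x≢y ∷ ≢-sym p≢y ∷ ≢-sym x₁≢y ∷ []) ∷ (≢-sym p≢x ∷ ≢-sym x₁≢x ∷ []) ∷ (p≢x₁ ∷ []) ∷ [] ∷ [])
        (here refl)

      fy : f y ≡ 2F
      fy = f-∈ (here refl)

      fx : f x ≡ 6F
      fx = f-∈ (there (here refl))

      fp : f p ≡ 1F
      fp = f-∈ (there (there (here refl)))

      fx₁ : f x₁ ≡ 4F
      fx₁ = f-∈ (there (there (there (here refl))))

      plain : ∀ {v i} → v ≢ y → v ≢ x → v ≢ p → v ≢ x₁ → k v ≡ i → f v ≡ shade (adj G p v) i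
      plain v≢y v≢x v≢p v≢x₁ kv =
        trans (f-∉ (All¬⇒¬Any (v≢y ∷ v≢x ∷ v≢p ∷ v≢x₁ ∷ []))) (cong (shade (adj G _ _)) kv)

      p≁y : ¬ Adj G p y
      p≁y py with complete Ny p (Adj-sym py)
      ... | inj₁ p≡x        = p≢x p≡x
      ... | inj₂ (inj₁ p≡z) = ≢-by-colour k kp kz (λ ()) p≡z
      ... | inj₂ (inj₂ p≡w) = p≢w p≡w

      special : ∀ s v → s ∈ S → Adj G s v → Far (f s) (f v)
      special _ v (here refl) yv with complete Ny v yv
      ... | inj₁ refl        = far fy fx
      ... | inj₂ (inj₁ refl) = far fy (plain z≢y z≢x (≢-by-colour k kz kp λ ())
                                              (≢-sym (x-neighbour≢z (adj-b Nx))) kz)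
      ... | inj₂ (inj₂ refl) = far fy (plain w≢y w≢x (≢-sym p≢w) (≢-by-colour k kw kx₁ λ ()) kw)
      special _ v (there (here refl)) xv with complete Nx v xv
      ... | inj₁ refl        = far fx fy
      ... | inj₂ (inj₁ refl) = far fx fx₁
      ... | inj₂ (inj₂ refl) = far fx fp
      special _ v (there (there (here refl))) = far-at-special p≢y fp kp outside inside v
        where
        outside : ∀ v → v ∉ S → v ≢ y → k v ≢ 2F → Adj G p v → Far 1F (shade (adj G p v) (k v))
        outside v _ _ kv≢2 pv =
          subst (λ b → Far 1F (shade b (k v))) (sym pv) (fits 1F 2F (shade true) (k v) kv≢2)

        inside : ∀ t → t ∈ S → Adj G p t → Far (f p) (f t)
        inside _ (here refl)                         py  = ⊥-elim (p≁y py)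
        inside _ (there (here refl))                 _   = far fp fx
        inside _ (there (there (here refl)))         pp  = ⊥-elim (Adj⇒≢ pp refl)
        inside _ (there (there (there (here refl)))) _   = far fp fx₁
      special _ v (there (there (there (here refl)))) = far-at-special x₁≢y fx₁ kx₁ outside inside v
        where
        outside : ∀ v → v ∉ S → v ≢ y → k v ≢ 1F → Adj G x₁ v → Far 4F (shade (adj G p v) (k v))
        outside v v∉S v≢y kv≢1 x₁v with adj G p v in pv
        ... | true  = ⊥-elim (no-fresh (v , (v∉S ∘ there ∘ here , v≢y , λ { refl → kv≢1 kz }) ,
                                        Adj-sym pv , Adj-sym x₁v))
        ... | false = fits 4F 1F (shade false) (k v) kv≢1

        inside : ∀ t → t ∈ S → Adj G x₁ t → Far (f x₁) (f t)
        inside _ (here refl)                         x₁y  = ⊥-elim (class1-x-neighbour≁y (adj-b Nx) kx₁ x₁y)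
        inside _ (there (here refl))                 _    = far fx₁ fx
        inside _ (there (there (here refl)))         _    = far fx₁ fp
        inside _ (there (there (there (here refl)))) x₁x₁ = ⊥-elim (Adj⇒≢ x₁x₁ refl)

    x-side : ∀ {a b} → Neighbours x y a b →
      ∃₂ λ x₁ p → Neighbours x y x₁ p × k x₁ ≡ 1F × k p ≡ 2F × Adj G w x₁ ×
                  (p ≢ w → ∃ (FreshCommonNeighbour p x₁))
    x-side Nx with neighbour-classes Nx
    ... | x₁ , p , Nx′ , kx₁ , kp =
      x₁ , p , Nx′ , kx₁ , kp ,
      decidable-stable (adj G w x₁ ≟ᵇ true) (no72 ∘ w≁x₁⇒Colouring72 Nx′ kx₁ kp) ,
      λ p≢w → decidable-stable (any? (FreshCommonNeighbour? p x₁))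
                               (no72 ∘ no-fresh-common-neighbour⇒Colouring72 Nx′ kx₁ kp p≢w)

  rainbow-neighbourhood : ∀ {y k a u₀ u₁ u₂} → ProperAwayFrom y k → a ≢ y → u₀ ≢ y → u₁ ≢ y → u₂ ≢ y →
    k u₀ ≡ 0F → k u₁ ≡ 1F → k u₂ ≡ 2F → Adj G a u₀ → Adj G a u₁ → Adj G a u₂ → ⊥
  rainbow-neighbourhood {k = k} {a} proper a≢y u₀≢y u₁≢y u₂≢y ku₀ ku₁ ku₂ au₀ au₁ au₂ with k a in ka
  ... | 0F = proper _ _ a≢y u₀≢y au₀ (trans ka (sym ku₀))
  ... | 1F = proper _ _ a≢y u₁≢y au₁ (trans ka (sym ku₁))
  ... | 2F = proper _ _ a≢y u₂≢y au₂ (trans ka (sym ku₂))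

  LabelledNeighbourhoods : Fin n → Fin n → Fin n → Set
  LabelledNeighbourhoods x y z =
    ∃ λ x' → ∃ λ x'' → ∃ λ y' → ∃ λ z' → ∃ λ z'' →
      (Adj G x x' × Adj G x x'' × x' ≢ x'' × x' ≢ y × x'' ≢ y) ×
      (Adj G y y' × y' ≢ x × y' ≢ z) ×
      (Adj G z z' × Adj G z z'' × z' ≢ z'' × z' ≢ y × z'' ≢ y) ×
      x' ≡ z' × Adj G y' x'' × Adj G y' z'' × x'' ≢ z'' ×
      (x' ≢ y' →
        ∃ λ a → ∃ λ b → a ≢ b ×
          (a ≢ x × a ≢ y × a ≢ z) × (b ≢ x × b ≢ y × b ≢ z) ×
          Adj G a x' × Adj G a x'' × Adj G b x' × Adj G b z'')

  module _ {y k} (proper : ProperAwayFrom y k) (no72 : ¬ Colouring72 G)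
      {x z w} (Ny : Neighbours y x z w) (kx : k x ≡ 0F) (kz : k z ≡ 1F) (kw : k w ≡ 2F)
      (x≁z : ¬ Adj G x z) where

    swap01 : Permutation′ 3
    swap01 = transpose 0F 1F

    module X = Configuration proper no72 Ny kx kz kw x≁z
    -- Exchanging colours 0 and 1 swaps the roles of x and z.
    module Z = Configuration (ProperAwayFrom-permute swap01 proper) no72 (swap₁₂ Ny)
                 (cong (swap01 ⟨$⟩ʳ_) kz) (cong (swap01 ⟨$⟩ʳ_) kx) (cong (swap01 ⟨$⟩ʳ_) kw)
                 (x≁z ∘ Adj-sym)

    z-side : ∀ {c d} → Neighbours z y c d →
      ∃₂ λ z₁ q → Neighbours z y z₁ q × k z₁ ≡ 0F × k q ≡ 2F × Adj G w z₁ ×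
                  (q ≢ w → ∃ (Z.FreshCommonNeighbour q z₁))
    z-side Nz with Z.x-side Nz
    ... | z₁ , q , Nz′ , kz₁ , kq , wz₁ , fresh =
      z₁ , q , Nz′ , ⟨$⟩ʳ-injective swap01 kz₁ , ⟨$⟩ʳ-injective swap01 kq , wz₁ , fresh

    labelled-neighbourhoods : ∀ {a b c d} → Neighbours x y a b → Neighbours z y c d →
      LabelledNeighbourhoods x y z
    labelled-neighbourhoods Nx Nz with X.x-side Nx | z-side Nz
    ... | x₁ , p , Nx′ , kx₁ , kp , wx₁ , fresh-x | z₁ , q , Nz′ , kz₁ , kq , wz₁ , fresh-z
      with decidable-stable (p ≟ q) (no72 ∘ X.distinct-class2⇒Colouring72 Nx′ Nz′ kx₁ kp kz₁ kq)
    ... | refl =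
      p , x₁ , w , p , z₁ ,
      (adj-c Nx′ , adj-b Nx′ , ≢-sym (b≢c Nx′) , ≢-sym (a≢c Nx′) , ≢-sym (a≢b Nx′)) ,
      (adj-c Ny , ≢-sym (a≢c Ny) , ≢-sym (b≢c Ny)) ,
      (adj-c Nz′ , adj-b Nz′ , ≢-sym (b≢c Nz′) , ≢-sym (a≢c Nz′) , ≢-sym (a≢b Nz′)) ,
      refl , wx₁ , wz₁ , ≢-by-colour k kx₁ kz₁ (λ ()) ,
      λ p≢w →
        let a , (a≢x , a≢y , a≢z) , ap , ax₁ = fresh-x p≢w
            b , (b≢z , b≢y , b≢x) , bp , bz₁ = fresh-z p≢w
            distinct : a ≢ b
            distinct a≡b = rainbow-neighbourhood proper a≢y (≢-sym (a≢b Nz′)) (≢-sym (a≢b Nx′))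
              (≢-sym (a≢c Nx′)) kz₁ kx₁ kp (subst (λ t → Adj G t z₁) (sym a≡b) bz₁) ax₁ ap
        in a , b , distinct , (a≢x , a≢y , a≢z) , (b≢x , b≢y , b≢z) , ap , ax₁ , bp , bz₁
      where open Neighbours

lemma6p1 : ∀ {n} (G : Graph n) → Critical 4 G → ¬ Colouring72 G → ¬ D3HasOddCycle G →
    (x y z : Fin n) → deg G x ≡ 3 → deg G y ≡ 3 → deg G z ≡ 3 →
    Adj G x y → Adj G y z → x ≢ z →
    ∃ λ x' → ∃ λ x'' → ∃ λ y' → ∃ λ z' → ∃ λ z'' →
      (Adj G x x' × Adj G x x'' × x' ≢ x'' × x' ≢ y × x'' ≢ y) ×
      (Adj G y y' × y' ≢ x × y' ≢ z) ×
      (Adj G z z' × Adj G z z'' × z' ≢ z'' × z' ≢ y × z'' ≢ y) ×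
      x' ≡ z' × Adj G y' x'' × Adj G y' z'' × x'' ≢ z'' ×
      (x' ≢ y' →
        ∃ λ a → ∃ λ b → a ≢ b ×
          (a ≢ x × a ≢ y × a ≢ z) × (b ≢ x × b ≢ y × b ≢ z) ×
          Adj G a x' × Adj G a x'' × Adj G b x' × Adj G b z'')
lemma6p1 G critical no72 noOdd x y z dx dy dz xy yz x≢z
  with degree3⇒Neighbours G dx xy | degree3⇒Neighbours G dz (Adj-sym G yz)
     | degree3⇒Neighbours G dy (Adj-sym G xy)
... | _ , _ , Nx | _ , _ , Nz | _ , _ , Ny₀ with third-neighbour G Ny₀ yz (≢-sym x≢z)
... | w , Ny with standard-colouring G critical Ny
... | k , proper , kx , kz , kw = labelled-neighbourhoods G proper no72 Ny kx kz kw x≁z Nx Nz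
  where
  x≁z : ¬ Adj G x z
  x≁z xz = noOdd (triangle⇒D3HasOddCycle G dx dy dz xy yz (Adj-sym G xz))
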